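{- Let $\mathbf{u}$ be an infinite or finite word over a finite alphabet $\mathcal{A}$. Then $\mathbf{u}$ is $\Theta$-rich if and only if both: (i) for each nonempty factor $v$ of $\mathbf{u}$, every factor of $\mathbf{u}$ that begins with $v$, ends with $\Theta(v)$, and contains no other occurrences of $v$ or $\Theta(v)$, is a $\Theta$-palindrome; and (ii) for every letter $a\in\mathcal{A}$, the occurrences of $a$ and $\Theta(a)$ in $\mathbf{u}$ alternate.
   Context: $\Theta$ is an involutory antimorphism of $\mathcal{A}^*$ ($\Theta^2=\mathrm{id}$, $\Theta(vw)=\Theta(w)\Theta(v)$); a word $v$ is a $\Theta$-palindrome if $\Theta(v)=v$. For a finite word $w$, $\gamma(w)=\{\{a,\Theta(a)\}: a\in\mathcal{A},\ a\neq\Theta(a),\ a\text{ or }\Theta(a)\text{ occurs in } w\}$. A finite word $w$ is $\Theta$-rich if it has exactly $|w|+1-\#\gamma(w)$ distinct $\Theta$-palindromic factors (empty word included); an infinite word is $\Theta$-rich if all its finite factors are. Occurrences of $a$ and $\Theta(a)$ alternate if there is no factor of $\mathbf{u}$ of length at least $2$ beginning and ending with $a$ and not containing $\Theta(a)$, and likewise with $a$ and $\Theta(a)$ exchanged. -}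

module Defs where

open import Data.Nat using (ℕ; _+_; _∸_; _≤_)
open import Data.Fin as Fin using (Fin; toℕ)
open import Data.Fin.Properties using () renaming (_≟_ to _≟ᶠ_)
open import Data.List using (List; []; _∷_; _++_; [_]; length; map; reverse; concatMap; inits; tails; filter; deduplicate; tabulate; allFin)
open import Data.List.Properties using (≡-dec)
open import Data.List.Membership.Propositional using (_∈_; _∉_)
open import Data.List.Relation.Unary.Any using (any?)
open import Data.Product using (Σ; ∃; _×_; _,_)
open import Data.Sum using (_⊎_)
open import Relation.Nullary using (¬_; Dec)
open import Relation.Nullary.Decidable using (_×-dec_; _⊎-dec_)
open import Relation.Binary.PropositionalEquality using (_≡_; _≢_)

data Word (k : ℕ) : Set where
  finite   : List (Fin k) → Word k
  infinite : (ℕ → Fin k) → Word k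

module _ {k : ℕ} (θ : Fin k → Fin k) where

  Θ : List (Fin k) → List (Fin k)
  Θ w = reverse (map θ w)

  IsΘPal : List (Fin k) → Set
  IsΘPal v = Θ v ≡ v

  isΘPal? : (v : List (Fin k)) → Dec (IsΘPal v)
  isΘPal? v = ≡-dec _≟ᶠ_ (Θ v) v

  factors : List (Fin k) → List (List (Fin k))
  factors w = concatMap inits (tails w)

  -- the distinct Θ-palindromic factors of w (empty word included)
  distinctΘPalFactors : List (Fin k) → List (List (Fin k))
  distinctΘPalFactors w = deduplicate (≡-dec _≟ᶠ_) (filter isΘPal? (factors w))

  -- #γ(w): each pair {a, θ a} with a ≠ θ a, where a or θ a occurs in w,
  -- is counted once, via its smaller element (toℕ a < toℕ (θ a)).
  #γ : List (Fin k) → ℕ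
  #γ w = length (filter (λ a → (a Fin.<? θ a) ×-dec (any? (a ≟ᶠ_) w ⊎-dec any? (θ a ≟ᶠ_) w)) (allFin k))

  ΘRichFinite : List (Fin k) → Set
  ΘRichFinite w = length (distinctΘPalFactors w) ≡ (length w + 1) ∸ #γ w

  factorAt : (ℕ → Fin k) → ℕ → (n : ℕ) → List (Fin k)
  factorAt u i n = tabulate {n = n} (λ j → u (i + toℕ j))

  IsFactor : Word k → List (Fin k) → Set
  IsFactor (finite w)   v = Σ (List (Fin k)) λ x → Σ (List (Fin k)) λ y → x ++ v ++ y ≡ w
  IsFactor (infinite u) v = Σ ℕ λ i → factorAt u i (length v) ≡ v

  ΘRich : Word k → Set
  ΘRich (finite w)   = ΘRichFinite w
  ΘRich (infinite u) = ∀ v → IsFactor (infinite u) v → ΘRichFinite v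

  CondI : Word k → Set
  CondI u = ∀ (v : List (Fin k)) → v ≢ [] → IsFactor u v →
            ∀ (f : List (Fin k)) → IsFactor u f →
            (Σ (List (Fin k)) λ y → v ++ y ≡ f) →
            (Σ (List (Fin k)) λ x → x ++ Θ v ≡ f) →
            -- every occurrence of v or Θ(v) in f is the prefix one or the suffix one
            (∀ (x y : List (Fin k)) → (x ++ v ++ y ≡ f ⊎ x ++ Θ v ++ y ≡ f) → x ≡ [] ⊎ y ≡ []) →
            IsΘPal f

  Alternate : Word k → Fin k → Set
  Alternate u a =
    (∀ (f : List (Fin k)) → IsFactor u f → 2 ≤ length f →
       (Σ (List (Fin k)) λ y → a ∷ y ≡ f) → (Σ (List (Fin k)) λ x → x ++ [ a ] ≡ f) →
       ¬ (θ a ∉ f))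
    ×
    (∀ (f : List (Fin k)) → IsFactor u f → 2 ≤ length f →
       (Σ (List (Fin k)) λ y → θ a ∷ y ≡ f) → (Σ (List (Fin k)) λ x → x ++ [ θ a ] ≡ f) →
       ¬ (a ∉ f))

  CondII : Word k → Set
  CondII u = ∀ (a : Fin k) → Alternate u a

module Submission where

-- Write palγ(w) = #Pal(w) + #γ(w). Appending a letter a to w raises palγ by one exactly when
-- {a, θ a} is a new pair (a ≠ θ a and neither letter occurs in w) or w a has a Θ-palindromic
-- suffix that does not occur in w (such a suffix is unique, and the two cases exclude each
-- other); otherwise palγ is unchanged. Hence palγ(w) ≤ |w| + 1, with equality, i.e. Θ-richness,
-- iff every step of w is of one of these two kinds. This passes to prefixes trivially, and to
-- suffixes because palγ is invariant under Θ. In a rich word the last step of a complete return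
-- f to v cannot create a new pair (f starts with θ of its last letter), so it creates a
-- Θ-palindromic suffix, which comparison with the suffix Θ(v) forces to be f itself;
-- alternation follows in the same way. Conversely, under (i) and (ii) let P be the longest
-- Θ-palindromic suffix of p a. If P occurs in p, a complete return to P ending at a is a longer
-- Θ-palindromic suffix by (i); if P is empty although a or θ a occurs in p, the last such
-- occurrence starts a complete return to θ a, a Θ-palindrome by (i), or a factor a … a without
-- θ a, contradicting (ii). An infinite word and both conditions are determined by the finite
-- factors.

open import Defs
open import Data.Nat using (ℕ; suc; _+_; _∸_; _≤_; _<_; z≤n; s≤s)
open import Data.Nat.Properties
open import Data.Nat.Induction using (<-wellFounded)
open import Data.Fin as Fin using (Fin; toℕ)
open import Data.Fin.Properties using () renaming (_≟_ to _≟ᶠ_)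
import Data.Fin.Properties as Finₚ
open import Data.List using (List; []; _∷_; _++_; [_]; _∷ʳ_; length; map; reverse; inits; tails; filter; allFin)
open import Data.List.Properties
open import Data.List.Reverse using (Reverse; []; _∶_∶ʳ_; reverseView)
open import Data.List.Membership.Propositional using (_∈_; _∉_; find; lose)
open import Data.List.Membership.Propositional.Properties hiding (finite)
open import Data.List.Relation.Binary.Subset.Propositional using (_⊆_)
open import Data.List.Relation.Unary.Any as Any using (Any; here; there; any?)
open import Data.List.Relation.Unary.Any.Properties using (reverse⁺; reverse⁻)
open import Data.List.Relation.Unary.All as All using (All; []; _∷_)
open import Data.List.Relation.Unary.All.Properties using (¬Any⇒All¬)
open import Data.List.Relation.Unary.AllPairs using ([]; _∷_)
open import Data.List.Relation.Unary.Unique.Propositional using (Unique)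
import Data.List.Relation.Unary.Unique.Propositional.Properties as Unique
open import Data.Product using (Σ; _×_; _,_; proj₁; proj₂; map₁; map₂)
open import Data.Sum using (_⊎_; inj₁; inj₂; [_,_]′)
open import Data.Empty using (⊥-elim)
open import Function using (id; _∘_)
open import Function.Bundles using (_⇔_; mk⇔; Equivalence)
open import Function.Construct.Composition using (_⇔-∘_)
open import Function.Construct.Symmetry using (⇔-sym)
open import Induction.WellFounded using (Acc; acc)
open import Level using (0ℓ)
open import Relation.Nullary using (¬_; Dec; yes; no; contradiction)
open import Relation.Nullary.Decidable using (map′; _×-dec_; _⊎-dec_; ¬?)
open import Relation.Unary using (Pred; Decidable; ∁)
open import Relation.Binary.Definitions using (tri<; tri≈; tri>)
open import Relation.Binary.PropositionalEquality using (_≡_; _≢_; refl; sym; trans; cong; cong₂; subst; subst₂; module ≡-Reasoning)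

module _ {A : Set} where

  Unique-⊆⇒length-≤ : ∀ {xs ys : List A} → Unique xs → xs ⊆ ys → length xs ≤ length ys
  Unique-⊆⇒length-≤ {[]} _ _ = z≤n
  Unique-⊆⇒length-≤ {x ∷ xs} {ys} (x∉xs ∷ uxs) xs⊆ys with ∈-∃++ (xs⊆ys (here refl))
  ... | ys₁ , ys₂ , refl = begin
    suc (length xs)             ≤⟨ s≤s (Unique-⊆⇒length-≤ uxs xs⊆ys₁ys₂) ⟩
    suc (length (ys₁ ++ ys₂))   ≡⟨ cong suc (length-++ ys₁) ⟩
    suc (length ys₁ + length ys₂) ≡⟨ +-suc (length ys₁) (length ys₂) ⟨
    length ys₁ + suc (length ys₂) ≡⟨ length-++ ys₁ ⟨
    length (ys₁ ++ [ x ] ++ ys₂) ∎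
    where
    open ≤-Reasoning
    xs⊆ys₁ys₂ : xs ⊆ ys₁ ++ ys₂
    xs⊆ys₁ys₂ {z} z∈xs with ∈-++⁻ ys₁ (xs⊆ys (there z∈xs))
    ... | inj₁ z∈ys₁          = ∈-++⁺ˡ z∈ys₁
    ... | inj₂ (here refl)    = ⊥-elim (All.lookup x∉xs z∈xs refl)
    ... | inj₂ (there z∈ys₂)  = ∈-++⁺ʳ ys₁ z∈ys₂

  Unique-⊆-⊇⇒length-≡ : ∀ {xs ys : List A} → Unique xs → Unique ys → xs ⊆ ys → ys ⊆ xs → length xs ≡ length ys
  Unique-⊆-⊇⇒length-≡ uxs uys xs⊆ys ys⊆xs = ≤-antisym (Unique-⊆⇒length-≤ uxs xs⊆ys) (Unique-⊆⇒length-≤ uys ys⊆xs)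

  ∀-cong-⇔ : ∀ {P Q R : A → Set} → (∀ x → Q x ⇔ R x) → (∀ x → P x → Q x) ⇔ (∀ x → P x → R x)
  ∀-cong-⇔ Q⇔R = mk⇔ (λ h x px → Equivalence.to (Q⇔R x) (h x px)) (λ h x px → Equivalence.from (Q⇔R x) (h x px))

  length-filter-extend : ∀ {P Q : Pred A 0ℓ} (P? : Decidable P) (Q? : Decidable Q) {c xs} →
    Unique xs → c ∈ xs → Q c → ¬ P c → (∀ {b} → P b → Q b) → (∀ {b} → Q b → P b ⊎ b ≡ c) →
    length (filter Q? xs) ≡ suc (length (filter P? xs))
  length-filter-extend P? Q? {c} {xs} uxs c∈xs Qc ¬Pc P⇒Q Q⇒P∨c =
    Unique-⊆-⊇⇒length-≡ (Unique.filter⁺ Q? uxs) (c∉ ∷ Unique.filter⁺ P? uxs) Q⊆cP cP⊆Q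
    where
    c∉ : All (c ≢_) (filter P? xs)
    c∉ = All.tabulate λ b∈ c≡b → ¬Pc (subst _ (sym c≡b) (proj₂ (∈-filter⁻ P? {xs = xs} b∈)))
    Q⊆cP : filter Q? xs ⊆ c ∷ filter P? xs
    Q⊆cP b∈ with ∈-filter⁻ Q? {xs = xs} b∈
    ... | b∈xs , Qb = [ (λ Pb → there (∈-filter⁺ P? b∈xs Pb)) , here ]′ (Q⇒P∨c Qb)
    cP⊆Q : c ∷ filter P? xs ⊆ filter Q? xs
    cP⊆Q (here refl) = ∈-filter⁺ Q? c∈xs Qc
    cP⊆Q (there b∈) with ∈-filter⁻ P? {xs = xs} b∈
    ... | b∈xs , Pb = ∈-filter⁺ Q? b∈xs (P⇒Q Pb)

module _ {A : Set} where

  private variable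
    u v w x y : List A
    a : A

  Prefix : List A → List A → Set
  Prefix v w = Σ (List A) λ y → v ++ y ≡ w

  Suffix : List A → List A → Set
  Suffix v w = Σ (List A) λ x → x ++ v ≡ w

  Factor : List A → List A → Set
  Factor v w = Σ (List A) λ x → Σ (List A) λ y → x ++ v ++ y ≡ w

  length-∷ʳ : ∀ w (a : A) → length (w ∷ʳ a) ≡ suc (length w)
  length-∷ʳ w a = trans (length-++ w) (+-comm (length w) 1)

  ++-∷ʳ-assoc : ∀ x v y (a : A) → x ++ v ++ y ∷ʳ a ≡ (x ++ v ++ y) ∷ʳ a
  ++-∷ʳ-assoc x v y a = trans (cong (x ++_) (sym (++-assoc v y [ a ]))) (sym (++-assoc x (v ++ y) [ a ]))

  length-<-++-∷ʳ : ∀ v y (a : A) → length v < length (v ++ y ∷ʳ a)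
  length-<-++-∷ʳ v y a = subst (length v <_) (sym (length-++ v)) (m<m+n (length v) (subst (0 <_) (sym (length-∷ʳ y a)) (s≤s z≤n)))

  Factor-refl : ∀ w → Factor w w
  Factor-refl w = [] , [] , ++-identityʳ w

  []-Factor : ∀ w → Factor [] w
  []-Factor w = [] , w , refl

  Prefix⇒Factor : Prefix v w → Factor v w
  Prefix⇒Factor (y , v++y≡w) = [] , y , v++y≡w

  Suffix⇒Factor : Suffix v w → Factor v w
  Suffix⇒Factor {v} (x , x++v≡w) = x , [] , trans (cong (x ++_) (++-identityʳ v)) x++v≡w

  Factor-trans : Factor u v → Factor v w → Factor u w
  Factor-trans {u} (x , y , refl) (x′ , y′ , refl) = x′ ++ x , y ++ y′ , (begin
    (x′ ++ x) ++ u ++ y ++ y′   ≡⟨ ++-assoc x′ x (u ++ y ++ y′) ⟩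
    x′ ++ x ++ u ++ y ++ y′     ≡⟨ cong (λ z → x′ ++ x ++ z) (++-assoc u y y′) ⟨
    x′ ++ x ++ (u ++ y) ++ y′   ≡⟨ cong (x′ ++_) (++-assoc x (u ++ y) y′) ⟨
    x′ ++ (x ++ u ++ y) ++ y′   ∎)
    where open ≡-Reasoning

  Factor-∷ʳ⁺ : Factor v w → Factor v (w ∷ʳ a)
  Factor-∷ʳ⁺ {v} {a = a} (x , y , refl) = x , y ∷ʳ a , ++-∷ʳ-assoc x v y a

  Factor-of-proper-prefix : x ++ v ++ y ≡ w ∷ʳ a → y ≢ [] → Factor v w
  Factor-of-proper-prefix {x} {v} {y} eq y≢[] with reverseView y
  ... | []            = contradiction refl y≢[]
  ... | y′ ∶ _ ∶ʳ b   = x , y′ , ∷ʳ-injectiveˡ (x ++ v ++ y′) _ (begin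
    (x ++ v ++ y′) ∷ʳ b   ≡⟨ ++-assoc x (v ++ y′) [ b ] ⟩
    x ++ (v ++ y′) ∷ʳ b   ≡⟨ cong (x ++_) (++-assoc v y′ [ b ]) ⟩
    x ++ v ++ y′ ∷ʳ b     ≡⟨ eq ⟩
    _                     ∎)
    where open ≡-Reasoning

  Factor-∷ʳ⁻ : Factor v (w ∷ʳ a) → Factor v w ⊎ Suffix v (w ∷ʳ a)
  Factor-∷ʳ⁻ {v} (x , [] , eq)    = inj₂ (x , trans (cong (x ++_) (sym (++-identityʳ v))) eq)
  Factor-∷ʳ⁻ (x , _ ∷ _ , eq)     = inj₁ (Factor-of-proper-prefix {x = x} eq λ ())

  Suffix-length : Suffix v w → length v ≤ length w
  Suffix-length {v} (x , refl) = length-++-≤ʳ v {x}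

  Suffix-of-shorter : ∀ {c d} → Suffix c w → Suffix d w → length d ≤ length c → Suffix d c
  Suffix-of-shorter {c = c} ([] , refl) (t , refl) _ = t , refl
  Suffix-of-shorter {c = c} {d} (_ ∷ s , refl) ([] , d≡) |d|≤|c| =
    contradiction |d|≤|c| (<⇒≱ (subst (length c <_) (sym (cong length d≡)) (s≤s (length-++-≤ʳ c {s}))))
  Suffix-of-shorter (_ ∷ s , refl) (_ ∷ t , eq) = Suffix-of-shorter (s , refl) (t , ∷-injectiveʳ eq)

  Suffix-trans : Suffix u v → Suffix v w → Suffix u w
  Suffix-trans {u} (x , refl) (x′ , refl) = x′ ++ x , ++-assoc x′ x u

  ∈-∷ʳ⁻ : ∀ {b} → b ∈ w ∷ʳ a → b ∈ w ⊎ b ≡ a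
  ∈-∷ʳ⁻ {w} b∈ with ∈-++⁻ w b∈
  ... | inj₁ b∈w        = inj₁ b∈w
  ... | inj₂ (here b≡a) = inj₂ b≡a

  Factor-singleton⇒∈ : Factor [ a ] w → a ∈ w
  Factor-singleton⇒∈ (x , _ , refl) = ∈-++⁺ʳ x (here refl)

  lastOccurrence : ∀ {P : Pred A 0ℓ} → Decidable P → Any P w →
                   Σ (List A) λ x → Σ A λ b → Σ (List A) λ z → w ≡ x ++ b ∷ z × P b × All (∁ P) z
  lastOccurrence {b ∷ w} P? any-bw with any? P? w
  ... | yes any-w with lastOccurrence P? any-w
  ...   | x , c , z , refl , Pc , none = b ∷ x , c , z , refl , Pc , none
  lastOccurrence {b ∷ w} P? (here Pb)   | no ¬any-w = [] , b , w , refl , Pb , ¬Any⇒All¬ w ¬any-w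
  lastOccurrence {b ∷ w} P? (there any-w) | no ¬any-w = contradiction any-w ¬any-w

  length≡0⇒≡[] : length w ≡ 0 → w ≡ []
  length≡0⇒≡[] {[]} _ = refl

  Suffix-proper-length : (a ∷ x) ++ v ≡ w → length v < length w
  Suffix-proper-length {x = x} {v} refl = s≤s (length-++-≤ʳ v {x})

  Prefix⇒∈-inits : Prefix v w → v ∈ inits w
  Prefix⇒∈-inits {[]}    {w = []}    _ = here refl
  Prefix⇒∈-inits {[]}    {w = _ ∷ _} _ = here refl
  Prefix⇒∈-inits {b ∷ v} (y , refl)    = there (∈-map⁺ (b ∷_) (Prefix⇒∈-inits {v} (y , refl)))

  ∈-inits⇒Prefix : ∀ w → v ∈ inits w → Prefix v w
  ∈-inits⇒Prefix []      (here refl) = [] , refl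
  ∈-inits⇒Prefix (b ∷ w) (here refl) = b ∷ w , refl
  ∈-inits⇒Prefix (b ∷ w) (there v∈) with ∈-map⁻ (b ∷_) v∈
  ... | v′ , v′∈ , refl = map₂ (cong (b ∷_)) (∈-inits⇒Prefix w v′∈)

  Suffix⇒∈-tails : Suffix v w → v ∈ tails w
  Suffix⇒∈-tails {[]}    ([] , refl)    = here refl
  Suffix⇒∈-tails {_ ∷ _} ([] , refl)    = here refl
  Suffix⇒∈-tails         (_ ∷ x , refl) = there (Suffix⇒∈-tails (x , refl))

  ∈-tails⇒Suffix : ∀ w → v ∈ tails w → Suffix v w
  ∈-tails⇒Suffix []      (here refl) = [] , refl
  ∈-tails⇒Suffix (b ∷ w) (here refl) = [] , refl
  ∈-tails⇒Suffix (b ∷ w) (there v∈)  = Data.Product.map (b ∷_) (cong (b ∷_)) (∈-tails⇒Suffix w v∈)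

module Richness {k : ℕ} (θ : Fin k → Fin k) (θ-involutive : ∀ a → θ (θ a) ≡ a) where

  private
    L : Set
    L = List (Fin k)

    Θ′ : L → L
    Θ′ = Θ θ

    variable
      u v w c d f g : L
      a b e : Fin k

  θ-injective : θ a ≡ θ b → a ≡ b
  θ-injective {a} {b} θa≡θb = trans (sym (θ-involutive a)) (trans (cong θ θa≡θb) (θ-involutive b))

  Θ-∷ : ∀ a u → Θ′ (a ∷ u) ≡ Θ′ u ∷ʳ θ a
  Θ-∷ a u = unfold-reverse (θ a) (map θ u)

  Θ-++ : ∀ u v → Θ′ (u ++ v) ≡ Θ′ v ++ Θ′ u
  Θ-++ u v = trans (cong reverse (map-++ θ u v)) (reverse-++ (map θ u) (map θ v))

  Θ-Θ : ∀ u → Θ′ (Θ′ u) ≡ u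
  Θ-Θ []      = refl
  Θ-Θ (a ∷ u) = begin
    Θ′ (Θ′ (a ∷ u))             ≡⟨ cong Θ′ (Θ-∷ a u) ⟩
    Θ′ (Θ′ u ∷ʳ θ a)            ≡⟨ Θ-++ (Θ′ u) [ θ a ] ⟩
    θ (θ a) ∷ Θ′ (Θ′ u)         ≡⟨ cong₂ _∷_ (θ-involutive a) (Θ-Θ u) ⟩
    a ∷ u                       ∎
    where open ≡-Reasoning

  length-Θ : ∀ u → length (Θ′ u) ≡ length u
  length-Θ u = trans (length-reverse (map θ u)) (length-map θ u)

  ∈-Θ⁻ : b ∈ Θ′ w → θ b ∈ w
  ∈-Θ⁻ {w = w} b∈ with ∈-map⁻ θ (reverse⁻ b∈)
  ... | c , c∈w , refl = subst (_∈ w) (sym (θ-involutive c)) c∈w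

  ∈-Θ⁺ : θ b ∈ w → b ∈ Θ′ w
  ∈-Θ⁺ {b} {w} θb∈w = reverse⁺ (subst (_∈ map θ w) (θ-involutive b) (∈-map⁺ θ θb∈w))

  Θ-Factor : Factor v w → Factor (Θ′ v) (Θ′ w)
  Θ-Factor {v} (x , y , refl) = Θ′ y , Θ′ x , (begin
    Θ′ y ++ Θ′ v ++ Θ′ x      ≡⟨ ++-assoc (Θ′ y) (Θ′ v) (Θ′ x) ⟨
    (Θ′ y ++ Θ′ v) ++ Θ′ x    ≡⟨ cong (_++ Θ′ x) (Θ-++ v y) ⟨
    Θ′ (v ++ y) ++ Θ′ x       ≡⟨ Θ-++ x (v ++ y) ⟨
    Θ′ (x ++ v ++ y)          ∎)
    where open ≡-Reasoning

  Θ-Factor⁻ : Factor v (Θ′ w) → Factor (Θ′ v) w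
  Θ-Factor⁻ {w = w} f = subst (Factor _) (Θ-Θ w) (Θ-Factor f)

  Suffix-Θ⇒Prefix : Suffix u (Θ′ v) → Prefix (Θ′ u) v
  Suffix-Θ⇒Prefix {u} {v} (r , r++u≡Θv) = Θ′ r , (begin
    Θ′ u ++ Θ′ r      ≡⟨ Θ-++ r u ⟨
    Θ′ (r ++ u)       ≡⟨ cong Θ′ r++u≡Θv ⟩
    Θ′ (Θ′ v)         ≡⟨ Θ-Θ v ⟩
    v                 ∎)
    where open ≡-Reasoning

  ΘPal-Suffix-Θ⇒Prefix : IsΘPal θ c → Suffix (Θ′ d) c → Prefix d c
  ΘPal-Suffix-Θ⇒Prefix {c} {d} Θc≡c s =
    subst (λ z → Prefix z c) (Θ-Θ d) (Suffix-Θ⇒Prefix {v = c} (subst (Suffix (Θ′ d)) (sym Θc≡c) s))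

  ΘPal-∷ʳ : IsΘPal θ (c ∷ʳ a) → θ a ∷ Θ′ c ≡ c ∷ʳ a
  ΘPal-∷ʳ {c} {a} = trans (sym (Θ-++ c [ a ]))

  Factor⇒∈-factors : Factor v w → v ∈ factors θ w
  Factor⇒∈-factors {v} (x , y , eq) =
    ∈-concatMap⁺ inits (lose (Suffix⇒∈-tails (x , eq)) (Prefix⇒∈-inits {v = v} (y , refl)))

  ∈-factors⇒Factor : ∀ w → v ∈ factors θ w → Factor v w
  ∈-factors⇒Factor w v∈ with find (∈-concatMap⁻ inits {xs = tails w} v∈)
  ... | t , t∈ , v∈t with ∈-tails⇒Suffix w t∈ | ∈-inits⇒Prefix t v∈t
  ... | x , refl | y , refl = x , y , refl

  Factor? : ∀ v w → Dec (Factor v w)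
  Factor? v w = map′ (∈-factors⇒Factor w) Factor⇒∈-factors (v ∈? factors θ w)
    where open import Data.List.Membership.DecPropositional (≡-dec _≟ᶠ_) using (_∈?_)

  Unique-distinctΘPalFactors : ∀ w → Unique (distinctΘPalFactors θ w)
  Unique-distinctΘPalFactors w = deduplicate-! (filter (isΘPal? θ) (factors θ w))
    where open import Data.List.Relation.Unary.Unique.DecPropositional.Properties (≡-dec _≟ᶠ_) using (deduplicate-!)

  ∈-distinctΘPalFactors⁻ : ∀ w → v ∈ distinctΘPalFactors θ w → IsΘPal θ v × Factor v w
  ∈-distinctΘPalFactors⁻ w v∈
    with ∈-filter⁻ (isΘPal? θ) (∈-deduplicate⁻ (≡-dec _≟ᶠ_) (filter (isΘPal? θ) (factors θ w)) v∈)
  ... | v∈factors , pal = pal , ∈-factors⇒Factor w v∈factors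

  ∈-distinctΘPalFactors⁺ : IsΘPal θ v → Factor v w → v ∈ distinctΘPalFactors θ w
  ∈-distinctΘPalFactors⁺ pal f = ∈-deduplicate⁺ (≡-dec _≟ᶠ_) (∈-filter⁺ (isΘPal? θ) (Factor⇒∈-factors f) pal)

  NewLetterPair : L → Fin k → Set
  NewLetterPair w a = a ≢ θ a × a ∉ w × θ a ∉ w

  NewΘPalSuffix : L → Fin k → Set
  NewΘPalSuffix w a = Σ L λ c → Suffix c (w ∷ʳ a) × IsΘPal θ c × ¬ Factor c w

  RichStep : L → Fin k → Set
  RichStep w a = NewLetterPair w a ⊎ NewΘPalSuffix w a

  RichSteps : L → Set
  RichSteps w = ∀ p a q → (p ∷ʳ a) ++ q ≡ w → RichStep p a

  newLetterPair? : ∀ w a → Dec (NewLetterPair w a)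
  newLetterPair? w a = ¬? (a ≟ᶠ θ a) ×-dec ¬? (a ∈? w) ×-dec ¬? (θ a ∈? w)
    where open import Data.List.Membership.DecPropositional (_≟ᶠ_ {k}) using (_∈?_)

  newΘPalSuffix? : ∀ w a → Dec (NewΘPalSuffix w a)
  newΘPalSuffix? w a with any? (λ c → isΘPal? θ c ×-dec ¬? (Factor? c w)) (tails (w ∷ʳ a))
  ... | yes some with find some
  ...   | c , c∈ , pal , ¬f = yes (c , ∈-tails⇒Suffix (w ∷ʳ a) c∈ , pal , ¬f)
  newΘPalSuffix? w a | no none = no λ (c , sc , pal , ¬f) → none (lose (Suffix⇒∈-tails sc) (pal , ¬f))

  richStep? : ∀ w a → Dec (RichStep w a)
  richStep? w a = newLetterPair? w a ⊎-dec newΘPalSuffix? w a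

  NewΘPalSuffix⇒θ∈ : NewΘPalSuffix w a → a ≡ θ a ⊎ θ a ∈ w
  NewΘPalSuffix⇒θ∈ {w} (c , sc , pal , ¬f) with reverseView c | sc
  ... | []            | _       = contradiction ([]-Factor w) ¬f
  ... | c′ ∶ _ ∶ʳ b   | s , eq  with ∷ʳ-injective (s ++ c′) w (trans (++-assoc s c′ [ b ]) eq)
  ...   | s++c′≡w , refl with c′ | ΘPal-∷ʳ pal
  ...     | []       | θa∷[]≡a∷[] = inj₁ (sym (∷-injectiveˡ θa∷[]≡a∷[]))
  ...     | b′ ∷ c″  | θa∷≡b′∷    =
    inj₂ (subst (_∈ w) (sym (∷-injectiveˡ θa∷≡b′∷)) (subst (b′ ∈_) s++c′≡w (∈-++⁺ʳ s (here refl))))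

  NewLetterPair⇒¬NewΘPalSuffix : NewLetterPair w a → ¬ NewΘPalSuffix w a
  NewLetterPair⇒¬NewΘPalSuffix (a≢θa , _ , θa∉w) new = [ a≢θa , θa∉w ]′ (NewΘPalSuffix⇒θ∈ new)

  palFactors : L → List L
  palFactors = distinctΘPalFactors θ

  ΘPalSuffix-≤-unique : Suffix c (w ∷ʳ a) → Suffix d (w ∷ʳ a) → IsΘPal θ c → IsΘPal θ d →
                        ¬ Factor d w → length d ≤ length c → c ≡ d
  ΘPalSuffix-≤-unique {c} {d = d} (s , sc) sd pc pd ¬fd |d|≤|c|
    with ΘPal-Suffix-Θ⇒Prefix pc (subst (λ z → Suffix z c) (sym pd) (Suffix-of-shorter (s , sc) sd |d|≤|c|))
  ... | [] , d++[]≡c    = trans (sym d++[]≡c) (++-identityʳ d)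
  ... | _ ∷ _ , d++r≡c  = contradiction (Factor-of-proper-prefix {x = s} (trans (cong (s ++_) d++r≡c) sc) λ ()) ¬fd

  NewΘPalSuffix-unique : Suffix c (w ∷ʳ a) → Suffix d (w ∷ʳ a) → IsΘPal θ c → IsΘPal θ d →
                         ¬ Factor c w → ¬ Factor d w → c ≡ d
  NewΘPalSuffix-unique {c} {d = d} sc sd pc pd ¬fc ¬fd with ≤-total (length d) (length c)
  ... | inj₁ |d|≤|c| = ΘPalSuffix-≤-unique sc sd pc pd ¬fd |d|≤|c|
  ... | inj₂ |c|≤|d| = sym (ΘPalSuffix-≤-unique sd sc pd pc ¬fc |c|≤|d|)

  Factor-∷ʳ-old⊎new : ∀ w a → Factor v (w ∷ʳ a) → Factor v w ⊎ (Suffix v (w ∷ʳ a) × ¬ Factor v w)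
  Factor-∷ʳ-old⊎new {v} w a f with Factor-∷ʳ⁻ f | Factor? v w
  ... | inj₁ fw | _      = inj₁ fw
  ... | inj₂ _  | yes fw = inj₁ fw
  ... | inj₂ sv | no ¬fw = inj₂ (sv , ¬fw)

  palFactors-∷ʳ-⊇ : ∀ w a → palFactors w ⊆ palFactors (w ∷ʳ a)
  palFactors-∷ʳ-⊇ w a v∈ with ∈-distinctΘPalFactors⁻ w v∈
  ... | pal , f = ∈-distinctΘPalFactors⁺ pal (Factor-∷ʳ⁺ f)

  length-palFactors-∷ʳ-new : ∀ w a → NewΘPalSuffix w a → length (palFactors (w ∷ʳ a)) ≡ suc (length (palFactors w))
  length-palFactors-∷ʳ-new w a (c , sc , pc , ¬fc) =
    Unique-⊆-⊇⇒length-≡ (Unique-distinctΘPalFactors (w ∷ʳ a)) (c∉ ∷ Unique-distinctΘPalFactors w) ⊆c∷ c∷⊆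
    where
    c∉ : All (c ≢_) (palFactors w)
    c∉ = All.tabulate λ v∈ c≡v → ¬fc (subst (λ z → Factor z w) (sym c≡v) (proj₂ (∈-distinctΘPalFactors⁻ w v∈)))
    ⊆c∷ : palFactors (w ∷ʳ a) ⊆ c ∷ palFactors w
    ⊆c∷ v∈ with ∈-distinctΘPalFactors⁻ (w ∷ʳ a) v∈
    ... | pv , fv with Factor-∷ʳ-old⊎new w a fv
    ...   | inj₁ fw = there (∈-distinctΘPalFactors⁺ pv fw)
    ...   | inj₂ (sv , ¬fv) = here (NewΘPalSuffix-unique sv sc pv pc ¬fv ¬fc)
    c∷⊆ : c ∷ palFactors w ⊆ palFactors (w ∷ʳ a)
    c∷⊆ (here refl) = ∈-distinctΘPalFactors⁺ pc (Suffix⇒Factor sc)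
    c∷⊆ (there v∈)  = palFactors-∷ʳ-⊇ w a v∈

  length-palFactors-∷ʳ-old : ∀ w a → ¬ NewΘPalSuffix w a → length (palFactors (w ∷ʳ a)) ≡ length (palFactors w)
  length-palFactors-∷ʳ-old w a ¬new =
    Unique-⊆-⊇⇒length-≡ (Unique-distinctΘPalFactors (w ∷ʳ a)) (Unique-distinctΘPalFactors w) ⊆old (palFactors-∷ʳ-⊇ w a)
    where
    ⊆old : palFactors (w ∷ʳ a) ⊆ palFactors w
    ⊆old v∈ with ∈-distinctΘPalFactors⁻ (w ∷ʳ a) v∈
    ... | pv , fv with Factor-∷ʳ-old⊎new w a fv
    ...   | inj₁ fw         = ∈-distinctΘPalFactors⁺ pv fw
    ...   | inj₂ (sv , ¬fv) = contradiction (_ , sv , pv , ¬fv) ¬new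

  SamePair : Fin k → Fin k → Set
  SamePair b a = b ≡ a ⊎ θ b ≡ a

  SamePair-sym : SamePair b a → SamePair a b
  SamePair-sym (inj₁ refl)  = inj₁ refl
  SamePair-sym {b} (inj₂ refl) = inj₂ (θ-involutive b)

  SamePair-trans : SamePair b a → SamePair a e → SamePair b e
  SamePair-trans (inj₁ refl) p = p
  SamePair-trans {b} (inj₂ refl) (inj₁ refl) = inj₂ refl
  SamePair-trans {b} (inj₂ refl) (inj₂ refl) = inj₁ (sym (θ-involutive b))

  SamePair-∈ : SamePair b a → a ∈ w ⊎ θ a ∈ w → b ∈ w ⊎ θ b ∈ w
  SamePair-∈ (inj₁ refl) a∈ = a∈
  SamePair-∈ {b} {w = w} (inj₂ refl) (inj₁ θb∈) = inj₂ θb∈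
  SamePair-∈ {b} {w = w} (inj₂ refl) (inj₂ θθb∈) = inj₁ (subst (_∈ w) (θ-involutive b) θθb∈)

  SamePair-fixed : SamePair b a → a ≡ θ a → b ≡ θ b
  SamePair-fixed (inj₁ refl) a≡θa = a≡θa
  SamePair-fixed (inj₂ refl) θb≡θθb = θ-injective θb≡θθb

  SamePair-ordered-unique : b Fin.< θ b → e Fin.< θ e → SamePair b e → b ≡ e
  SamePair-ordered-unique _ _ (inj₁ b≡e) = b≡e
  SamePair-ordered-unique {b} b<θb θb<θθb (inj₂ refl) =
    contradiction (subst (θ b Fin.<_) (θ-involutive b) θb<θθb) (Finₚ.<-asym b<θb)

  γPair : L → Fin k → Set
  γPair w b = b Fin.< θ b × (b ∈ w ⊎ θ b ∈ w)

  γPair? : ∀ w → Decidable (γPair w)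
  γPair? w b = (b Fin.<? θ b) ×-dec (any? (b ≟ᶠ_) w ⊎-dec any? (θ b ≟ᶠ_) w)

  γPair-∷ʳ⁺ : γPair w b → γPair (w ∷ʳ a) b
  γPair-∷ʳ⁺ (b<θb , b∈) = b<θb , Data.Sum.map ∈-++⁺ˡ ∈-++⁺ˡ b∈

  γPair-∷ʳ⁻ : γPair (w ∷ʳ a) b → γPair w b ⊎ (b Fin.< θ b × SamePair b a)
  γPair-∷ʳ⁻ {w} (b<θb , inj₁ b∈) with ∈-∷ʳ⁻ {w = w} b∈
  ... | inj₁ b∈w  = inj₁ (b<θb , inj₁ b∈w)
  ... | inj₂ b≡a  = inj₂ (b<θb , inj₁ b≡a)
  γPair-∷ʳ⁻ {w} (b<θb , inj₂ θb∈) with ∈-∷ʳ⁻ {w = w} θb∈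
  ... | inj₁ θb∈w = inj₁ (b<θb , inj₂ θb∈w)
  ... | inj₂ θb≡a = inj₂ (b<θb , inj₂ θb≡a)

  orderedRepresentative : a ≢ θ a → Σ (Fin k) λ r → r Fin.< θ r × SamePair r a
  orderedRepresentative {a} a≢θa with Finₚ.<-cmp a (θ a)
  ... | tri< a<θa _ _ = a , a<θa , inj₁ refl
  ... | tri≈ _ a≡θa _ = contradiction a≡θa a≢θa
  ... | tri> _ _ θa<a = θ a , subst (θ a Fin.<_) (sym (θ-involutive a)) θa<a , inj₂ (θ-involutive a)

  #γ-∷ʳ-new : ∀ w a → NewLetterPair w a → #γ θ (w ∷ʳ a) ≡ suc (#γ θ w)
  #γ-∷ʳ-new w a (a≢θa , a∉w , θa∉w) with orderedRepresentative a≢θa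
  ... | r , r<θr , r~a =
    length-filter-extend (γPair? w) (γPair? (w ∷ʳ a)) (Unique.allFin⁺ k) (∈-allFin r) γPair-r ¬γPair-r γPair-∷ʳ⁺ onlyNew
    where
    γPair-r : γPair (w ∷ʳ a) r
    γPair-r = r<θr , SamePair-∈ r~a (inj₁ (∈-++⁺ʳ w (here refl)))
    ¬γPair-r : ¬ γPair w r
    ¬γPair-r (_ , r∈w) = [ a∉w , θa∉w ]′ (SamePair-∈ (SamePair-sym r~a) r∈w)
    onlyNew : ∀ {b} → γPair (w ∷ʳ a) b → γPair w b ⊎ b ≡ r
    onlyNew γb with γPair-∷ʳ⁻ {w} γb
    ... | inj₁ γb′         = inj₁ γb′
    ... | inj₂ (b<θb , b~a) = inj₂ (SamePair-ordered-unique b<θb r<θr (SamePair-trans b~a (SamePair-sym r~a)))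

  ¬NewLetterPair⇒fixed⊎occurs : ∀ w a → ¬ NewLetterPair w a → a ≡ θ a ⊎ (a ∈ w ⊎ θ a ∈ w)
  ¬NewLetterPair⇒fixed⊎occurs w a ¬new with a ≟ᶠ θ a | a ∈? w | θ a ∈? w
    where open import Data.List.Membership.DecPropositional (_≟ᶠ_ {k}) using (_∈?_)
  ... | yes a≡θa | _        | _         = inj₁ a≡θa
  ... | no _     | yes a∈w  | _         = inj₂ (inj₁ a∈w)
  ... | no _     | no _     | yes θa∈w  = inj₂ (inj₂ θa∈w)
  ... | no a≢θa  | no a∉w   | no θa∉w   = contradiction (a≢θa , a∉w , θa∉w) ¬new

  #γ-∷ʳ-old : ∀ w a → ¬ NewLetterPair w a → #γ θ (w ∷ʳ a) ≡ #γ θ w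
  #γ-∷ʳ-old w a ¬new = cong length (filter-≐ (γPair? (w ∷ʳ a)) (γPair? w) (γPair-∷ʳ⁻′ , γPair-∷ʳ⁺) (allFin k))
    where
    γPair-∷ʳ⁻′ : ∀ {b} → γPair (w ∷ʳ a) b → γPair w b
    γPair-∷ʳ⁻′ γb with γPair-∷ʳ⁻ {w} γb
    ... | inj₁ γb′ = γb′
    ... | inj₂ (b<θb , b~a) with ¬NewLetterPair⇒fixed⊎occurs w a ¬new
    ...   | inj₁ a≡θa = contradiction (SamePair-fixed b~a a≡θa) (Finₚ.<⇒≢ b<θb)
    ...   | inj₂ a∈w  = b<θb , SamePair-∈ b~a a∈w

  palγ : L → ℕ
  palγ w = length (palFactors w) + #γ θ w

  palγ-∷ʳ-rich : ∀ w a → RichStep w a → palγ (w ∷ʳ a) ≡ suc (palγ w)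
  palγ-∷ʳ-rich w a (inj₁ new) =
    trans (cong₂ _+_ (length-palFactors-∷ʳ-old w a (NewLetterPair⇒¬NewΘPalSuffix new)) (#γ-∷ʳ-new w a new))
          (+-suc (length (palFactors w)) (#γ θ w))
  palγ-∷ʳ-rich w a (inj₂ new) =
    cong₂ _+_ (length-palFactors-∷ʳ-new w a new) (#γ-∷ʳ-old w a λ pair → NewLetterPair⇒¬NewΘPalSuffix pair new)

  palγ-∷ʳ-poor : ∀ w a → ¬ RichStep w a → palγ (w ∷ʳ a) ≡ palγ w
  palγ-∷ʳ-poor w a ¬rich =
    cong₂ _+_ (length-palFactors-∷ʳ-old w a (¬rich ∘ inj₂)) (#γ-∷ʳ-old w a (¬rich ∘ inj₁))

  palγ-[] : palγ [] ≡ 1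
  palγ-[] = cong (1 +_) (cong length (filter-none (γPair? []) {xs = allFin k} (All.tabulate λ { _ (_ , inj₁ ()) ; _ (_ , inj₂ ()) })))

  RichSteps-[] : RichSteps []
  RichSteps-[] []      _ _ ()
  RichSteps-[] (_ ∷ _) _ _ ()

  RichSteps-∷ʳ : ∀ w a → RichSteps (w ∷ʳ a) ⇔ (RichSteps w × RichStep w a)
  RichSteps-∷ʳ w a = mk⇔
    (λ rich → (λ p b q eq → rich p b (q ∷ʳ a) (trans (sym (++-assoc (p ∷ʳ b) q [ a ])) (cong (_∷ʳ a) eq)))
            , rich w a [] (++-identityʳ (w ∷ʳ a)))
    (λ (rich , step) → extend rich step)
    where
    extend : RichSteps w → RichStep w a → RichSteps (w ∷ʳ a)
    extend rich step p b q eq with reverseView q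
    ... | [] with ∷ʳ-injective p w (trans (sym (++-identityʳ (p ∷ʳ b))) eq)
    ...   | refl , refl = step
    extend rich step p b q eq | q′ ∶ _ ∶ʳ c =
      rich p b q′ (∷ʳ-injectiveˡ ((p ∷ʳ b) ++ q′) w (trans (++-assoc (p ∷ʳ b) q′ [ c ]) eq))

  palγ-≤ : ∀ w → palγ w ≤ suc (length w)
  palγ-≤ w = go (reverseView w)
    where
    go : ∀ {w} → Reverse w → palγ w ≤ suc (length w)
    go []              = ≤-reflexive palγ-[]
    go (w ∶ rw ∶ʳ a) with richStep? w a
    ... | yes rich = subst₂ _≤_ (sym (palγ-∷ʳ-rich w a rich)) (cong suc (sym (length-∷ʳ w a))) (s≤s (go rw))
    ... | no ¬rich = subst₂ _≤_ (sym (palγ-∷ʳ-poor w a ¬rich)) (cong suc (sym (length-∷ʳ w a))) (m≤n⇒m≤1+n (go rw))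

  palγ-∷ʳ-poor-< : ∀ w a → ¬ RichStep w a → palγ (w ∷ʳ a) < suc (length (w ∷ʳ a))
  palγ-∷ʳ-poor-< w a ¬rich = begin-strict
    palγ (w ∷ʳ a)           ≡⟨ palγ-∷ʳ-poor w a ¬rich ⟩
    palγ w                  ≤⟨ palγ-≤ w ⟩
    suc (length w)          <⟨ n<1+n _ ⟩
    suc (suc (length w))    ≡⟨ cong suc (length-∷ʳ w a) ⟨
    suc (length (w ∷ʳ a))   ∎
    where open ≤-Reasoning

  palγ≡⇔RichSteps : ∀ w → palγ w ≡ suc (length w) ⇔ RichSteps w
  palγ≡⇔RichSteps w = go (reverseView w)
    where
    go : ∀ {w} → Reverse w → palγ w ≡ suc (length w) ⇔ RichSteps w
    go [] = mk⇔ (λ _ → RichSteps-[]) (λ _ → palγ-[])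
    go (w ∶ rw ∶ʳ a) with richStep? w a | go rw
    ... | yes rich | ih = mk⇔
      (λ eq → Equivalence.from (RichSteps-∷ʳ w a)
                (Equivalence.to ih (suc-injective
                  (trans (sym (palγ-∷ʳ-rich w a rich)) (trans eq (cong suc (length-∷ʳ w a))))) , rich))
      (λ steps → trans (palγ-∷ʳ-rich w a rich) (cong suc
                   (trans (Equivalence.from ih (proj₁ (Equivalence.to (RichSteps-∷ʳ w a) steps))) (sym (length-∷ʳ w a)))))
    ... | no ¬rich | _ = mk⇔
      (λ eq → contradiction eq (<⇒≢ (palγ-∷ʳ-poor-< w a ¬rich)))
      (λ steps → contradiction (proj₂ (Equivalence.to (RichSteps-∷ʳ w a) steps)) ¬rich)

  ΘRichFinite⇔palγ≡ : ∀ w → ΘRichFinite θ w ⇔ palγ w ≡ suc (length w)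
  ΘRichFinite⇔palγ≡ w = mk⇔
    (λ rich → begin
      palγ w                               ≡⟨ cong (_+ #γ θ w) rich ⟩
      (length w + 1) ∸ #γ θ w + #γ θ w     ≡⟨ m∸n+n≡m #γ≤ ⟩
      length w + 1                         ≡⟨ +-comm (length w) 1 ⟩
      suc (length w)                       ∎)
    (λ eq → begin
      length (palFactors w)                ≡⟨ m+n∸n≡m (length (palFactors w)) (#γ θ w) ⟨
      palγ w ∸ #γ θ w                      ≡⟨ cong (_∸ #γ θ w) (trans eq (+-comm 1 (length w))) ⟩
      (length w + 1) ∸ #γ θ w              ∎)
    where
    open ≡-Reasoning
    #γ≤ : #γ θ w ≤ length w + 1
    #γ≤ = ≤-trans (m≤n+m (#γ θ w) _) (≤-trans (palγ-≤ w) (≤-reflexive (+-comm 1 (length w))))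

  ΘRichFinite⇔RichSteps : ∀ w → ΘRichFinite θ w ⇔ RichSteps w
  ΘRichFinite⇔RichSteps w = palγ≡⇔RichSteps w ⇔-∘ ΘRichFinite⇔palγ≡ w

  palγ-Θ : ∀ w → palγ (Θ′ w) ≡ palγ w
  palγ-Θ w = cong₂ _+_
    (Unique-⊆-⊇⇒length-≡ (Unique-distinctΘPalFactors (Θ′ w)) (Unique-distinctΘPalFactors w) ⊆w ⊆Θw)
    (cong length (filter-≐ (γPair? (Θ′ w)) (γPair? w) (map₂ γ⁻ , map₂ γ⁺) (allFin k)))
    where
    ⊆w : palFactors (Θ′ w) ⊆ palFactors w
    ⊆w v∈ with ∈-distinctΘPalFactors⁻ (Θ′ w) v∈
    ... | pal , f = ∈-distinctΘPalFactors⁺ pal (subst (λ z → Factor z w) pal (Θ-Factor⁻ f))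
    ⊆Θw : palFactors w ⊆ palFactors (Θ′ w)
    ⊆Θw v∈ with ∈-distinctΘPalFactors⁻ w v∈
    ... | pal , f = ∈-distinctΘPalFactors⁺ pal (subst (λ z → Factor z (Θ′ w)) pal (Θ-Factor f))
    γ⁻ : b ∈ Θ′ w ⊎ θ b ∈ Θ′ w → b ∈ w ⊎ θ b ∈ w
    γ⁻ {b} (inj₁ b∈)  = inj₂ (∈-Θ⁻ b∈)
    γ⁻ {b} (inj₂ θb∈) = inj₁ (subst (_∈ w) (θ-involutive b) (∈-Θ⁻ θb∈))
    γ⁺ : b ∈ w ⊎ θ b ∈ w → b ∈ Θ′ w ⊎ θ b ∈ Θ′ w
    γ⁺ {b} (inj₁ b∈)  = inj₂ (∈-Θ⁺ (subst (_∈ w) (sym (θ-involutive b)) b∈))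
    γ⁺ {b} (inj₂ θb∈) = inj₁ (∈-Θ⁺ θb∈)

  RichSteps-Θ : ∀ w → RichSteps w → RichSteps (Θ′ w)
  RichSteps-Θ w steps = Equivalence.to (palγ≡⇔RichSteps (Θ′ w))
    (trans (palγ-Θ w) (trans (Equivalence.from (palγ≡⇔RichSteps w) steps) (cong suc (sym (length-Θ w)))))

  RichSteps-prefix : ∀ u v → RichSteps (u ++ v) → RichSteps u
  RichSteps-prefix u v steps p b q eq = steps p b (q ++ v) (trans (sym (++-assoc (p ∷ʳ b) q v)) (cong (_++ v) eq))

  RichSteps-suffix : ∀ u v → RichSteps (u ++ v) → RichSteps v
  RichSteps-suffix u v steps = subst RichSteps (Θ-Θ v)
    (RichSteps-Θ (Θ′ v) (RichSteps-prefix (Θ′ v) (Θ′ u) (subst RichSteps (Θ-++ u v) (RichSteps-Θ (u ++ v) steps))))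

  RichSteps-Factor : Factor v w → RichSteps w → RichSteps v
  RichSteps-Factor {v} (x , y , refl) steps = RichSteps-prefix v y (RichSteps-suffix x (v ++ y) steps)

  NoInteriorOccurrence : L → L → Set
  NoInteriorOccurrence v f = ∀ x y → x ++ v ++ y ≡ f → x ≡ [] ⊎ y ≡ []

  NewLetterPair⇒θ∉ : NewLetterPair g b → θ b ∉ g ∷ʳ b
  NewLetterPair⇒θ∉ {g} (b≢θb , _ , θb∉g) θb∈ = [ θb∉g , b≢θb ∘ sym ]′ (∈-∷ʳ⁻ {w = g} θb∈)

  RichStep-repeat⇒θ∈ : RichStep g b → b ∈ g → θ b ∈ g ∷ʳ b
  RichStep-repeat⇒θ∈ (inj₁ (_ , b∉g , _)) b∈g = contradiction b∈g b∉g
  RichStep-repeat⇒θ∈ {g} (inj₂ new) _ =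
    [ (λ b≡θb → ∈-++⁺ʳ g (here (sym b≡θb))) , ∈-++⁺ˡ ]′ (NewΘPalSuffix⇒θ∈ new)

  Prefix-Suffix-Θ⇒θ∈ : v ≢ [] → Prefix v (g ∷ʳ b) → Suffix (Θ′ v) (g ∷ʳ b) → θ b ∈ g ∷ʳ b
  Prefix-Suffix-Θ⇒θ∈ {[]} v≢[] = contradiction refl v≢[]
  Prefix-Suffix-Θ⇒θ∈ {v₀ ∷ v} {g} {b} _ (y , v₀v++y≡f) (x , x++Θv₀v≡f) =
    subst (_∈ g ∷ʳ b) v₀≡θb (subst (v₀ ∈_) v₀v++y≡f (here refl))
    where
    θv₀≡b : θ v₀ ≡ b
    θv₀≡b = ∷ʳ-injectiveʳ (x ++ Θ′ v) g
      (trans (trans (++-assoc x (Θ′ v) [ θ v₀ ]) (cong (x ++_) (sym (Θ-∷ v₀ v)))) x++Θv₀v≡f)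
    v₀≡θb : v₀ ≡ θ b
    v₀≡θb = trans (sym (θ-involutive v₀)) (cong θ θv₀≡b)

  ΘPalSuffix-short⇒Factor : IsΘPal θ c → Suffix c (Θ′ v) → length c < length v → Prefix v (g ∷ʳ b) → Factor c g
  ΘPalSuffix-short⇒Factor {c} pc sc |c|<|v| (y , v++y≡f) with Suffix-Θ⇒Prefix sc
  ... | r , Θc++r≡v with subst (λ z → z ++ r ≡ _) pc Θc++r≡v
  ...   | c++r≡v with r
  ...     | [] = contradiction (subst (length c <_) (cong length (trans (sym c++r≡v) (++-identityʳ c))) |c|<|v|) (<-irrefl refl)
  ...     | r₀ ∷ r′ = Factor-of-proper-prefix {x = []}
                        (trans (sym (++-assoc c (r₀ ∷ r′) y)) (trans (cong (_++ y) c++r≡v) v++y≡f)) λ ()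

  ΘPalSuffix-long⇒whole : Suffix c (g ∷ʳ b) → IsΘPal θ c → ¬ Factor c g → Suffix (Θ′ v) c →
                          Prefix v (g ∷ʳ b) → NoInteriorOccurrence v (g ∷ʳ b) → c ≡ g ∷ʳ b
  ΘPalSuffix-long⇒whole {c} {v = v} (s , s++c≡f) pc ¬fc sΘv (y , v++y≡f) noInterior
    with ΘPal-Suffix-Θ⇒Prefix pc sΘv
  ... | t , v++t≡c with noInterior s t (trans (cong (s ++_) v++t≡c) s++c≡f)
  ...   | inj₁ refl = s++c≡f
  ...   | inj₂ refl with c≡v ← trans (sym v++t≡c) (++-identityʳ v) | y
  ...     | []    = trans c≡v (trans (sym (++-identityʳ v)) v++y≡f)
  ...     | _ ∷ _ = contradiction (Factor-of-proper-prefix {x = []} (subst (λ z → z ++ _ ≡ _) (sym c≡v) v++y≡f) λ ()) ¬fc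

  RichSteps⇒return-ΘPal : v ≢ [] → RichSteps f → Prefix v f → Suffix (Θ′ v) f → NoInteriorOccurrence v f → IsΘPal θ f
  RichSteps⇒return-ΘPal {v} {f} v≢[] steps pv sΘv noInterior with reverseView f
  ... | [] = contradiction (++-conicalˡ v _ (proj₂ pv)) v≢[]
  ... | g ∶ _ ∶ʳ b with steps g b [] (++-identityʳ (g ∷ʳ b))
  ...   | inj₁ new = contradiction (Prefix-Suffix-Θ⇒θ∈ v≢[] pv sΘv) (NewLetterPair⇒θ∉ new)
  ...   | inj₂ (c , sc , pc , ¬fc) with length (Θ′ v) ≤? length c
  ...     | yes |Θv|≤|c| = subst (IsΘPal θ) (ΘPalSuffix-long⇒whole sc pc ¬fc (Suffix-of-shorter sc sΘv |Θv|≤|c|) pv noInterior) pc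
  ...     | no |Θv|≰|c|  = contradiction (ΘPalSuffix-short⇒Factor pc (Suffix-of-shorter sΘv sc (<⇒≤ |c|<|Θv|))
                                            (subst (length c <_) (length-Θ v) |c|<|Θv|) pv) ¬fc
    where |c|<|Θv| = ≰⇒> |Θv|≰|c|

  RichSteps⇒return-letter-θ∈ : RichSteps f → 2 ≤ length f → (Σ L λ y → b ∷ y ≡ f) → Suffix [ b ] f → θ b ∈ f
  RichSteps⇒return-letter-θ∈ {b = b} steps 2≤|f| (y , refl) (g , g++b≡f) with g
  ... | []     = contradiction 2≤|f| (subst (λ z → ¬ 2 ≤ length z) g++b≡f λ { (s≤s ()) })
  ... | g₀ ∷ g′ = subst (θ b ∈_) g++b≡f (RichStep-repeat⇒θ∈ (steps (g₀ ∷ g′) b [] (trans (++-identityʳ _) g++b≡f))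
                    (here (∷-injectiveˡ (sym g++b≡f))))

  RichSteps⇒CondI : RichSteps w → CondI θ (finite w)
  RichSteps⇒CondI steps v v≢[] _ f f⊑w pv sΘv noInterior =
    RichSteps⇒return-ΘPal v≢[] (RichSteps-Factor f⊑w steps) pv sΘv λ x y → noInterior x y ∘ inj₁

  RichSteps⇒CondII : RichSteps w → CondII θ (finite w)
  RichSteps⇒CondII steps a =
    (λ f f⊑w 2≤|f| pre suf θa∉f → θa∉f (RichSteps⇒return-letter-θ∈ (RichSteps-Factor f⊑w steps) 2≤|f| pre suf)) ,
    (λ f f⊑w 2≤|f| pre suf a∉f → a∉f (subst (_∈ f) (θ-involutive a)
                                   (RichSteps⇒return-letter-θ∈ (RichSteps-Factor f⊑w steps) 2≤|f| pre suf)))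

  longestΘPalSuffix : L → L
  longestΘPalSuffix []      = []
  longestΘPalSuffix (b ∷ u) with isΘPal? θ (b ∷ u)
  ... | yes _ = b ∷ u
  ... | no  _ = longestΘPalSuffix u

  longestΘPalSuffix-Suffix : ∀ u → Suffix (longestΘPalSuffix u) u
  longestΘPalSuffix-Suffix []      = [] , refl
  longestΘPalSuffix-Suffix (b ∷ u) with isΘPal? θ (b ∷ u)
  ... | yes _ = [] , refl
  ... | no  _ = Data.Product.map (b ∷_) (cong (b ∷_)) (longestΘPalSuffix-Suffix u)

  longestΘPalSuffix-ΘPal : ∀ u → IsΘPal θ (longestΘPalSuffix u)
  longestΘPalSuffix-ΘPal []      = refl
  longestΘPalSuffix-ΘPal (b ∷ u) with isΘPal? θ (b ∷ u)
  ... | yes pal = pal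
  ... | no  _   = longestΘPalSuffix-ΘPal u

  longestΘPalSuffix-longest : ∀ u → Suffix c u → IsΘPal θ c → length c ≤ length (longestΘPalSuffix u)
  longestΘPalSuffix-longest []      sc _ = Suffix-length sc
  longestΘPalSuffix-longest (b ∷ u) sc pc with isΘPal? θ (b ∷ u) | sc
  ... | yes _   | _              = Suffix-length sc
  ... | no ¬pal | []    , refl   = contradiction pc ¬pal
  ... | no _    | _ ∷ s , s++c≡u = longestΘPalSuffix-longest u (s , ∷-injectiveʳ s++c≡u) pc

  CompleteReturn : L → L → Set
  CompleteReturn c f = Prefix c f × Suffix c f × length c < length f × NoInteriorOccurrence c f

  noInterior-of-middle : ¬ Factor c f → NoInteriorOccurrence c (b ∷ f ∷ʳ a)
  noInterior-of-middle _   []      _       _  = inj₁ refl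
  noInterior-of-middle _   (_ ∷ _) []      _  = inj₂ refl
  noInterior-of-middle ¬fc (_ ∷ x) (_ ∷ _) eq = contradiction (Factor-of-proper-prefix {x = x} (∷-injectiveʳ eq) λ ()) ¬fc

  completeReturnSuffix : c ≢ [] → Prefix c f → Suffix c f → length c < length f →
                         Σ L λ f′ → Suffix f′ f × CompleteReturn c f′
  completeReturnSuffix {c} c≢[] = go (<-wellFounded _)
    where
    go : ∀ {f} → Acc _<_ (length f) → Prefix c f → Suffix c f → length c < length f →
         Σ L λ f′ → Suffix f′ f × CompleteReturn c f′
    go {h ∷ t} (acc rec) pc sc |c|<|f| with reverseView t
    ... | [] = contradiction (length≡0⇒≡[] (n<1⇒n≡0 |c|<|f|)) c≢[]
    ... | m ∶ _ ∶ʳ l with Factor? c m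
    ...   | no ¬fc = h ∷ m ∷ʳ l , ([] , refl) , pc , sc , |c|<|f| , noInterior-of-middle ¬fc
    -- an interior occurrence of c lies inside m; restart from it, on a strictly shorter suffix
    ...   | yes (x , y , x++c++y≡m) =
      map₂ (map₁ (λ sf′ → Suffix-trans sf′ (h ∷ x , f₁-suffix)))
        (go (rec (Suffix-proper-length {x = x} {v = f₁} f₁-suffix)) (y ∷ʳ l , refl) sc₁ |c|<|f₁|)
      where
      f₁ : L
      f₁ = c ++ y ∷ʳ l
      f₁-suffix : (h ∷ x) ++ f₁ ≡ h ∷ m ∷ʳ l
      f₁-suffix = cong (h ∷_) (trans (++-∷ʳ-assoc x c y l) (cong (_∷ʳ l) x++c++y≡m))
      |c|<|f₁| : length c < length f₁
      |c|<|f₁| = length-<-++-∷ʳ c y l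
      sc₁ : Suffix c f₁
      sc₁ = Suffix-of-shorter (h ∷ x , f₁-suffix) sc (<⇒≤ |c|<|f₁|)

  CondI⇒longerΘPalSuffix : ∀ {p} → CondI θ (finite (p ∷ʳ a)) →
                           c ≢ [] → IsΘPal θ c → Suffix c (p ∷ʳ a) → Factor c p →
                           Σ L λ c′ → Suffix c′ (p ∷ʳ a) × IsΘPal θ c′ × length c < length c′
  CondI⇒longerΘPalSuffix {a} {c} {p} condI c≢[] pc sc (x , y , x++c++y≡p) =
    longer (completeReturnSuffix c≢[] (y ∷ʳ a , refl) (Suffix-of-shorter sf sc (<⇒≤ |c|<|ret|)) |c|<|ret|)
    where
    ret : L
    ret = c ++ y ∷ʳ a
    sf : Suffix ret (p ∷ʳ a)
    sf = x , trans (++-∷ʳ-assoc x c y a) (cong (_∷ʳ a) x++c++y≡p)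
    |c|<|ret| : length c < length ret
    |c|<|ret| = length-<-++-∷ʳ c y a
    longer : (Σ L λ f′ → Suffix f′ ret × CompleteReturn c f′) →
             Σ L λ c′ → Suffix c′ (p ∷ʳ a) × IsΘPal θ c′ × length c < length c′
    longer (f′ , sf′ , pre , (s , s++c≡f′) , |c|<|f′| , noInterior) =
      f′ , Suffix-trans sf′ sf ,
      condI c c≢[] (Suffix⇒Factor sc) f′ (Suffix⇒Factor (Suffix-trans sf′ sf)) pre (s , trans (cong (s ++_) pc) s++c≡f′)
        (λ x′ y′ → [ noInterior x′ y′ , noInterior x′ y′ ∘ subst (λ z → x′ ++ z ++ y′ ≡ f′) pc ]′) ,
      |c|<|f′|

  samePair? : ∀ b a → Dec (SamePair b a)
  samePair? b a = (b ≟ᶠ a) ⊎-dec (θ b ≟ᶠ a)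

  noInterior-letter : b ∉ w → NoInteriorOccurrence [ b ] (e ∷ w ∷ʳ a)
  noInterior-letter b∉w = noInterior-of-middle (b∉w ∘ Factor-singleton⇒∈)

  CondI∧CondII⇒ΘPalSuffix : ∀ {p} → CondI θ (finite (p ∷ʳ a)) → CondII θ (finite (p ∷ʳ a)) → ¬ NewLetterPair p a →
                            Σ L λ c → Suffix c (p ∷ʳ a) × IsΘPal θ c × c ≢ []
  CondI∧CondII⇒ΘPalSuffix {a} {p} condI condII ¬new with a ≟ᶠ θ a | ¬NewLetterPair⇒fixed⊎occurs p a ¬new
  ... | yes a≡θa | _           = [ a ] , (p , refl) , cong [_] (sym a≡θa) , λ ()
  ... | no a≢θa  | inj₁ a≡θa   = contradiction a≡θa a≢θa
  ... | no a≢θa  | inj₂ pairOcc with lastOccurrence (λ e → samePair? e a) (pairOccurrence pairOcc)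
    where
    pairOccurrence : a ∈ p ⊎ θ a ∈ p → Any (λ e → SamePair e a) p
    pairOccurrence (inj₁ a∈p)  = Any.map (inj₁ ∘ sym) a∈p
    pairOccurrence (inj₂ θa∈p) = Any.map (λ { refl → inj₂ (θ-involutive a) }) θa∈p
  ...   | x , b , z , refl , inj₁ refl , noPair =
    ⊥-elim (proj₁ (condII a) ret (Suffix⇒Factor sret) (s≤s (subst (1 ≤_) (sym (length-∷ʳ z a)) (s≤s z≤n)))
                   (z ∷ʳ a , refl) (a ∷ z , refl) θa∉ret)
    where
    ret : L
    ret = a ∷ z ∷ʳ a
    sret : Suffix ret ((x ++ a ∷ z) ∷ʳ a)
    sret = x , sym (++-assoc x (a ∷ z) [ a ])
    θa∉ret : θ a ∉ ret
    θa∉ret (here θa≡a)  = a≢θa (sym θa≡a)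
    θa∉ret (there θa∈)  =
      [ (λ θa∈z → All.lookup noPair θa∈z (inj₂ (θ-involutive a))) , a≢θa ∘ sym ]′ (∈-∷ʳ⁻ {w = z} θa∈)
  ...   | x , b , z , refl , inj₂ refl , noPair = ret , sret , pal , λ ()
    where
    ret : L
    ret = b ∷ z ∷ʳ θ b
    sret : Suffix ret ((x ++ b ∷ z) ∷ʳ θ b)
    sret = x , sym (++-assoc x (b ∷ z) [ θ b ])
    pal : IsΘPal θ ret
    pal = condI [ b ] (λ ()) (Factor-trans (Prefix⇒Factor (z ∷ʳ θ b , refl)) (Suffix⇒Factor sret))
            ret (Suffix⇒Factor sret) (z ∷ʳ θ b , refl) (b ∷ z , refl)
            λ x′ y′ → [ noInterior-letter (λ b∈z → All.lookup noPair b∈z (inj₂ refl)) x′ y′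
                      , noInterior-letter (λ θb∈z → All.lookup noPair θb∈z (inj₁ refl)) x′ y′ ]′

  CondI∧CondII⇒RichStep : ∀ {p} → CondI θ (finite (p ∷ʳ a)) → CondII θ (finite (p ∷ʳ a)) → RichStep p a
  CondI∧CondII⇒RichStep {a} {p} condI condII with newLetterPair? p a
  ... | yes new = inj₁ new
  ... | no ¬new with Factor? (longestΘPalSuffix (p ∷ʳ a)) p
  ...   | no ¬fP = inj₂ (_ , longestΘPalSuffix-Suffix (p ∷ʳ a) , longestΘPalSuffix-ΘPal (p ∷ʳ a) , ¬fP)
  ...   | yes fP with CondI∧CondII⇒ΘPalSuffix condI condII ¬new
  ...     | c , sc , pc , c≢[]
    with CondI⇒longerΘPalSuffix condI P≢[] (longestΘPalSuffix-ΘPal (p ∷ʳ a)) (longestΘPalSuffix-Suffix (p ∷ʳ a)) fP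
    where
    P≢[] : longestΘPalSuffix (p ∷ʳ a) ≢ []
    P≢[] P≡[] = c≢[] (length≡0⇒≡[] (n≤0⇒n≡0
      (subst (λ z → length c ≤ length z) P≡[] (longestΘPalSuffix-longest _ sc pc))))
  ...       | c′ , sc′ , pc′ , |P|<|c′| = contradiction (longestΘPalSuffix-longest _ sc′ pc′) (<⇒≱ |P|<|c′|)

  factorAt-suc : ∀ u i n → factorAt θ u i (suc n) ≡ u i ∷ factorAt θ u (suc i) n
  factorAt-suc u i n = cong₂ _∷_ (cong u (+-identityʳ i)) (tabulate-cong λ j → cong u (+-suc i (toℕ j)))

  factorAt-prefix : ∀ u i x y → factorAt θ u i (length (x ++ y)) ≡ x ++ y → factorAt θ u i (length x) ≡ x
  factorAt-prefix u i []      y _  = refl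
  factorAt-prefix u i (b ∷ x) y eq with trans (sym (factorAt-suc u i (length (x ++ y)))) eq
  ... | eq′ = trans (factorAt-suc u i (length x))
                    (cong₂ _∷_ (∷-injectiveˡ eq′) (factorAt-prefix u (suc i) x y (∷-injectiveʳ eq′)))

  factorAt-suffix : ∀ u i x y → factorAt θ u i (length (x ++ y)) ≡ x ++ y → factorAt θ u (i + length x) (length y) ≡ y
  factorAt-suffix u i []      y eq = subst (λ j → factorAt θ u j (length y) ≡ y) (sym (+-identityʳ i)) eq
  factorAt-suffix u i (b ∷ x) y eq = subst (λ j → factorAt θ u j (length y) ≡ y) (sym (+-suc i (length x)))
    (factorAt-suffix u (suc i) x y (∷-injectiveʳ (trans (sym (factorAt-suc u i (length (x ++ y)))) eq)))

  IsFactor-trans : ∀ u → IsFactor θ u f → Factor v f → IsFactor θ u v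
  IsFactor-trans (finite w)   f⊑w          v⊑f              = Factor-trans v⊑f f⊑w
  IsFactor-trans (infinite u) (i , f≡)     (x , y , refl)   =
    i + length x , factorAt-prefix u (i + length x) _ y (factorAt-suffix u i x _ f≡)

  CondI-Factor : ∀ u → CondI θ u → IsFactor θ u f → CondI θ (finite f)
  CondI-Factor u condI f⊑u v v≢[] v⊑f g g⊑f = condI v v≢[] (IsFactor-trans u f⊑u v⊑f) g (IsFactor-trans u f⊑u g⊑f)

  CondII-Factor : ∀ u → CondII θ u → IsFactor θ u f → CondII θ (finite f)
  CondII-Factor u condII f⊑u a =
    (λ g g⊑f → proj₁ (condII a) g (IsFactor-trans u f⊑u g⊑f)) , (λ g g⊑f → proj₂ (condII a) g (IsFactor-trans u f⊑u g⊑f))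

  CondI∧CondII⇒RichSteps : ∀ w → CondI θ (finite w) → CondII θ (finite w) → RichSteps w
  CondI∧CondII⇒RichSteps w condI condII p a q eq =
    CondI∧CondII⇒RichStep (CondI-Factor (finite w) condI ([] , q , eq)) (CondII-Factor (finite w) condII ([] , q , eq))

  ΘRichFinite⇔CondI×CondII : ∀ w → ΘRichFinite θ w ⇔ (CondI θ (finite w) × CondII θ (finite w))
  ΘRichFinite⇔CondI×CondII w = mk⇔
    (λ rich → let steps = Equivalence.to (ΘRichFinite⇔RichSteps w) rich in RichSteps⇒CondI steps , RichSteps⇒CondII steps)
    (λ (condI , condII) → Equivalence.from (ΘRichFinite⇔RichSteps w) (CondI∧CondII⇒RichSteps w condI condII))

  ΘRich⇔factorwise : ∀ u → ΘRich θ u ⇔ (∀ f → IsFactor θ u f → ΘRichFinite θ f)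
  ΘRich⇔factorwise (finite w) = mk⇔
    (λ rich f f⊑w → Equivalence.from (ΘRichFinite⇔RichSteps f)
                      (RichSteps-Factor f⊑w (Equivalence.to (ΘRichFinite⇔RichSteps w) rich)))
    (λ rich → rich w (Factor-refl w))
  ΘRich⇔factorwise (infinite u) = mk⇔ id id

  CondI×CondII⇔factorwise : ∀ u → (CondI θ u × CondII θ u) ⇔
                            (∀ f → IsFactor θ u f → CondI θ (finite f) × CondII θ (finite f))
  CondI×CondII⇔factorwise u = mk⇔
    (λ (condI , condII) f f⊑u → CondI-Factor u condI f⊑u , CondII-Factor u condII f⊑u)
    (λ conds → (λ v v≢[] _ f f⊑u pre → proj₁ (conds f f⊑u) v v≢[] (Prefix⇒Factor pre) f (Factor-refl f) pre) ,
               (λ a → (λ f f⊑u → proj₁ (proj₂ (conds f f⊑u) a) f (Factor-refl f)) ,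
                      (λ f f⊑u → proj₂ (proj₂ (conds f f⊑u) a) f (Factor-refl f))))

proposition4p5 : ∀ {k : ℕ} (θ : Fin k → Fin k) → (∀ a → θ (θ a) ≡ a) →
    (u : Word k) → ΘRich θ u ⇔ (CondI θ u × CondII θ u)
proposition4p5 θ θ-involutive u =
  ⇔-sym (CondI×CondII⇔factorwise u) ⇔-∘ (∀-cong-⇔ ΘRichFinite⇔CondI×CondII ⇔-∘ ΘRich⇔factorwise u)
  where open Richness θ θ-involutive
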